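{- Let $G=(V,E)$ be a graph with a fixed ordering $\sigma$ of $V$, and let $M$ be the lexicographically-first maximum matching of $G$ with respect to $\sigma$. Then for every subset $F \subseteq E \setminus M$, the matching $M$ is also the lexicographically-first maximum matching of the graph $(V, E\setminus F)$.
   Context: Lexicographic order: given an ordering $\sigma: V \to \{1,\dots,n\}$, an edge $e_1=(u_1,v_1)$ with $\sigma(u_1)<\sigma(v_1)$ precedes an edge $e_2=(u_2,v_2)$ with $\sigma(u_2)<\sigma(v_2)$ if $\sigma(u_1)<\sigma(u_2)$, or $\sigma(u_1)=\sigma(u_2)$ and $\sigma(v_1)<\sigma(v_2)$. Two distinct maximum matchings are compared by listing their edges in increasing order and comparing these lists lexicographically (at the first index where they differ, the one with the smaller edge is smaller). The lexicographically-first maximum matching of a graph is the maximum matching that is smaller than every other maximum matching in this order. -}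

module Defs where

open import Data.Nat using (ℕ; _≤_; _<_)
open import Data.Fin using (Fin; toℕ)
open import Data.Fin.Permutation using (Permutation′; _⟨$⟩ʳ_; _⟨$⟩ˡ_)
open import Data.Bool using (Bool; true; false; _∧_; not)
open import Data.List using (List; []; _∷_; _++_; concatMap; length; allFin)
open import Data.Product using (_×_; _,_; ∃-syntax)
open import Data.Sum using (_⊎_)
open import Relation.Binary.PropositionalEquality using (_≡_; _≢_)
open import Relation.Nullary using (yes; no)
import Data.Nat as ℕ

-- Vertices are Fin n.  An edge set is a Boolean adjacency relation
-- (an edge {u,v} is present iff S u v ≡ true; edge sets are required
-- to be symmetric and loopless where relevant).
EdgeSet : ℕ → Set
EdgeSet n = Fin n → Fin n → Bool

Edge : ℕ → Set
Edge n = Fin n × Fin n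

-- An ordering σ : V → {1..n} is a bijection Fin n ↔ Fin n.
Ordering : ℕ → Set
Ordering n = Permutation′ n

IsGraph : ∀ {n} → EdgeSet n → Set
IsGraph {n} E = (∀ u v → E u v ≡ E v u) × (∀ u → E u u ≡ false)

_⊆E_ : ∀ {n} → EdgeSet n → EdgeSet n → Set
S ⊆E T = ∀ u v → S u v ≡ true → T u v ≡ true

_∖E_ : ∀ {n} → EdgeSet n → EdgeSet n → EdgeSet n
(E ∖E F) u v = E u v ∧ not (F u v)

-- the edges of S, each written (u , v) with σ(u) < σ(v), listed in
-- increasing lexicographic order w.r.t. σ
edgesOf : ∀ {n} → Ordering n → EdgeSet n → List (Edge n)
edgesOf {n} σ S =
  concatMap (λ i → concatMap (λ j → pick i j) (allFin n)) (allFin n)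
  where
  pick : Fin n → Fin n → List (Edge n)
  pick i j with toℕ i ℕ.<? toℕ j | S (σ ⟨$⟩ˡ i) (σ ⟨$⟩ˡ j)
  ... | yes _ | true = (σ ⟨$⟩ˡ i , σ ⟨$⟩ˡ j) ∷ []
  ... | _     | _    = []

size : ∀ {n} → Ordering n → EdgeSet n → ℕ
size σ S = length (edgesOf σ S)

EdgeLt : ∀ {n} → Ordering n → Edge n → Edge n → Set
EdgeLt σ (u₁ , v₁) (u₂ , v₂) =
  toℕ (σ ⟨$⟩ʳ u₁) < toℕ (σ ⟨$⟩ʳ u₂)
  ⊎ (toℕ (σ ⟨$⟩ʳ u₁) ≡ toℕ (σ ⟨$⟩ʳ u₂) × toℕ (σ ⟨$⟩ʳ v₁) < toℕ (σ ⟨$⟩ʳ v₂))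

LexLt : ∀ {n} → Ordering n → List (Edge n) → List (Edge n) → Set
LexLt {n} σ xs ys =
  ∃[ p ] ∃[ e ] ∃[ e' ] ∃[ r ] ∃[ r' ]
    (xs ≡ p ++ (e ∷ r)) × (ys ≡ p ++ (e' ∷ r')) × EdgeLt σ e e'

IsMatching : ∀ {n} → EdgeSet n → EdgeSet n → Set
IsMatching {n} E M =
  IsGraph M × (M ⊆E E) ×
  (∀ u v w → M u v ≡ true → M u w ≡ true → v ≡ w)

IsMaximumMatching : ∀ {n} → Ordering n → EdgeSet n → EdgeSet n → Set
IsMaximumMatching σ E M =
  IsMatching E M × (∀ M' → IsMatching E M' → size σ M' ≤ size σ M)

IsLexFirstMaxMatching : ∀ {n} → Ordering n → EdgeSet n → EdgeSet n → Set
IsLexFirstMaxMatching σ E M =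
  IsMaximumMatching σ E M ×
  (∀ M' → IsMaximumMatching σ E M' → edgesOf σ M' ≢ edgesOf σ M →
     LexLt σ (edgesOf σ M) (edgesOf σ M'))

-- Deleting edges outside M only shrinks the family of competing matchings,
-- while M itself survives and stays a matching.  Every matching of the smaller
-- graph is one of the larger graph, so M is still maximum; a maximum matching
-- of the smaller graph has the size of M and is therefore maximum in the larger
-- graph too, where M already beats it lexicographically.
module Submission where

open import Defs
open import Data.Nat using (ℕ)
open import Data.Nat.Properties using (≤-trans)
open import Data.Bool using (true; false)
open import Data.Product using (_×_; _,_; proj₂)
open import Relation.Binary.PropositionalEquality using (_≡_; refl; sym; trans)

∖E-⊆E : ∀ {n} (E F : EdgeSet n) → (E ∖E F) ⊆E E
∖E-⊆E E F u v E∖Fuv with E u v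
... | true = refl

⊆E-∖E : ∀ {n} {E F M : EdgeSet n} → M ⊆E E →
  (∀ u v → F u v ≡ true → M u v ≡ false) → M ⊆E (E ∖E F)
⊆E-∖E {E = E} {F} M⊆E M∩F=∅ u v Muv with E u v in Euv | F u v in Fuv
... | true  | false = refl
... | true  | true  with () ← trans (sym Muv) (M∩F=∅ u v Fuv)
... | false | _     with () ← trans (sym (M⊆E u v Muv)) Euv

IsMatching-mono : ∀ {n} {E E′ M : EdgeSet n} → E ⊆E E′ →
  IsMatching E M → IsMatching E′ M
IsMatching-mono E⊆E′ (graph , M⊆E , unique) =
  graph , (λ u v Muv → E⊆E′ u v (M⊆E u v Muv)) , unique

IsMatching-∖E : ∀ {n} {E F M : EdgeSet n} → IsMatching E M →
  (∀ u v → F u v ≡ true → M u v ≡ false) → IsMatching (E ∖E F) M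
IsMatching-∖E (graph , M⊆E , unique) M∩F=∅ =
  graph , ⊆E-∖E M⊆E M∩F=∅ , unique

module _ {n} (σ : Ordering n) {E E′ M : EdgeSet n} (E′⊆E : E′ ⊆E E) where

  IsMaximumMatching-restrict : IsMatching E′ M →
    IsMaximumMatching σ E M → IsMaximumMatching σ E′ M
  IsMaximumMatching-restrict M-match′ (_ , M-max) =
    M-match′ , λ M′ M′-match → M-max M′ (IsMatching-mono E′⊆E M′-match)

  IsMaximumMatching-extend : IsMatching E′ M → IsMaximumMatching σ E M →
    ∀ {M′} → IsMaximumMatching σ E′ M′ → IsMaximumMatching σ E M′
  IsMaximumMatching-extend M-match′ (_ , M-max) (M′-match , M′-max) =
    IsMatching-mono E′⊆E M′-match ,
    λ M″ M″-match → ≤-trans (M-max M″ M″-match) (M′-max M M-match′)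

  IsLexFirstMaxMatching-restrict : IsMatching E′ M →
    IsLexFirstMaxMatching σ E M → IsLexFirstMaxMatching σ E′ M
  IsLexFirstMaxMatching-restrict M-match′ (M-max , M-first) =
    IsMaximumMatching-restrict M-match′ M-max ,
    λ M′ M′-max → M-first M′ (IsMaximumMatching-extend M-match′ M-max M′-max)

mainTheorem2 : (n : ℕ) (σ : Ordering n) (E M F : EdgeSet n) →
    IsGraph E →
    IsLexFirstMaxMatching σ E M →
    IsGraph F →
    (∀ u v → F u v ≡ true → (E u v ≡ true) × (M u v ≡ false)) →
    IsLexFirstMaxMatching σ (E ∖E F) M
mainTheorem2 n σ E M F _ M-first@((M-match , _) , _) _ F⊆E∖M =
  IsLexFirstMaxMatching-restrict σ (∖E-⊆E E F)
    (IsMatching-∖E M-match (λ u v Fuv → proj₂ (F⊆E∖M u v Fuv))) M-first
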